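{- Let $q\ge1$ be an integer and $\lambda$ a mancala configuration with $\lambda\ge M^{q-1}$ and $|\lambda|\ge T_q$. Then there exists $0\le i<q$ such that either $\Phi^i(\lambda)\ge M^q$ or $\Phi^i(\lambda)$ is a $q$-canonical configuration. Moreover, if $\lambda$ is itself $q$-canonical, then either $\Phi^q(\lambda)\ge M^q$ or $\Phi^q(\lambda)$ is $q$-canonical.
   Context: $T_j=j(j+1)/2$. A mancala configuration is $\lambda:\mathbb N^*\to\mathbb N$ with support $\{1,\dots,\ell(\lambda)\}$; mass $|\lambda|=\sum\lambda_i$. Move $\Phi$: $\mu=\Phi(\lambda)$, $\mu_i=\lambda_{i+1}+1$ for $1\le i\le\lambda_1$, $\mu_i=\lambda_{i+1}$ for $i>\lambda_1$. Marching group $M^j_i=j-i+1$ ($i\le j$), $0$ otherwise ($M^0=0$); order componentwise. Energy-level picture: $\lambda$ is identified with the occupied cells $\{(i,j): i\ge1,\ i\le j\le\lambda_i+i-1\}$; level $j$ consists of cells $(1,j),\dots,(j,j)$. If $\lambda\ge M^{q-1}$ but not $\lambda\ge M^q$, the empty cells of level $q$ are gaps. A gap in column $c$ of $\lambda$ is tracked as rotating left along level $q$: at time $t$ it is at column $c_t\in\{1,\dots,q\}$, $c_t\equiv c-t\pmod q$; it is filled at the first $t\ge1$ at which cell $(c_t,q)$ is occupied in $\Phi^t(\lambda)$ (filling is permanent; if $|\lambda|\ge T_q$ all gaps get filled, one at a time). For $q\ge2$, $\lambda$ with $|\lambda|\ge T_q$ is $q$-canonical if (1) $\lambda\ge M^{q-1}$,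 (2) $\ell(\lambda)=q-1$, and (3) the gap in column $q$ of level $q$ is the last gap of level $q$ to be filled. -}

module Defs where

open import Data.Nat using (ℕ; zero; suc; _+_; _*_; _∸_; _≤_; _<_)
open import Data.Nat.DivMod using (_%_)
open import Data.List using (List; []; _∷_; length)
open import Data.Nat.ListAction using (sum)
open import Data.List.Relation.Unary.All using (All)
open import Data.Product using (Σ; Σ-syntax; _×_)
open import Relation.Nullary using (¬_)
open import Relation.Binary.PropositionalEquality using (_≡_)

-- A mancala configuration λ : ℕ* → ℕ with support {1,…,ℓ(λ)} is represented
-- by the list [λ₁, …, λ_ℓ] of its (positive) values.
Config : Set
Config = List ℕ

IsConfig : Config → Set
IsConfig c = All (λ x → 1 ≤ x) c

-- value λ_i (1-indexed; 0 outside the support, and at index 0)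
at : Config → ℕ → ℕ
at []       _             = 0
at (x ∷ xs) zero          = 0
at (x ∷ xs) (suc zero)    = x
at (x ∷ xs) (suc (suc i)) = at xs (suc i)

ℓ : Config → ℕ
ℓ = length

mass : Config → ℕ
mass = sum

T : ℕ → ℕ
T zero    = 0
T (suc j) = suc j + T j

addOnes : ℕ → Config → Config
addOnes zero    xs       = xs
addOnes (suc k) []       = 1 ∷ addOnes k []
addOnes (suc k) (y ∷ ys) = suc y ∷ addOnes k ys

-- the mancala move Φ: μ_i = λ_{i+1}+1 for i ≤ λ₁, μ_i = λ_{i+1} for i > λ₁
Φ : Config → Config
Φ []       = []
Φ (x ∷ xs) = addOnes x xs

Φ^ : ℕ → Config → Config
Φ^ zero    c = c
Φ^ (suc n) c = Φ (Φ^ n c)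

M : ℕ → ℕ → ℕ
M j zero    = 0
M j (suc i) with suc i Data.Nat.≤? j
... | Relation.Nullary.yes _ = j ∸ suc i + 1
... | Relation.Nullary.no  _ = 0

_≥M_ : Config → ℕ → Set
c ≥M j = ∀ i → 1 ≤ i → M j i ≤ at c i

Occ : Config → ℕ → ℕ → Set
Occ c i j = 1 ≤ i × i ≤ j × j < at c i + i

Gap : ℕ → Config → ℕ → Set
Gap q c col = 1 ≤ col × col ≤ q × ¬ Occ c col q

-- column at time t of the gap starting in column col of level q:
-- the unique element of {1,…,q} congruent to col - t mod q
rot : ℕ → ℕ → ℕ → ℕ
rot zero    col t = 0
rot (suc k) col t = suc ((col ∸ 1 + k * t) % suc k)

FilledAt : ℕ → Config → ℕ → ℕ → Set
FilledAt q c col t =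
  1 ≤ t × Occ (Φ^ t c) (rot q col t) q
  × (∀ s → 1 ≤ s → s < t → ¬ Occ (Φ^ s c) (rot q col s) q)

Canonical : ℕ → Config → Set
Canonical q c =
  2 ≤ q × T q ≤ mass c
  × c ≥M (q ∸ 1)
  × ℓ c ≡ q ∸ 1
  × Gap q c q
  × Σ[ tq ∈ ℕ ] (FilledAt q c q tq
      × (∀ col → Gap q c col → ¬ col ≡ q →
           Σ[ tc ∈ ℕ ] (FilledAt q c col tc × tc < tq)))

-- While λ ≥ M^(q-1), one move shifts every cell of level q one column to the left, the cell in
-- column 1 wrapping round to column q. So occupied cells of level q stay occupied as they rotate,
-- and a gap can only be filled as it wraps round from column 1 to column q: different gaps are
-- filled at different times. The potential ∑ i λᵢ grows over every round of q moves that starts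
-- with λ₁ = q - 1 and λ_{q+1} = 0, but is at most q |λ| while λ_{q+1} = 0; when |λ| ≥ T_q this
-- forces every gap to be filled. Let the gap p* be filled last, at time F, and let i < q be the
-- time when it passes column q. If F ≤ i, level q is full at time i; otherwise, at time i, the
-- gap in column q is the last one to be filled, so Φ^i λ is q-canonical. For a canonical λ the
-- same argument with p* = q and i = q (a full turn) gives the second claim.

module Submission where

open import Defs
open import Data.List using ([]; _∷_)
open import Data.List.Relation.Unary.All using ([]; _∷_)
open import Data.Nat
open import Data.Nat.DivMod using (_%_; %-distribˡ-+; m%n<n; [m+n]%n≡m%n; m<n⇒m%n≡m; m≤n⇒m%n≡m)
open import Data.Nat.Properties
open import Data.Nat.Tactic.RingSolver using (solve-∀)
open import Data.Product using (Σ-syntax; _×_; _,_; proj₁; proj₂)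
open import Data.Sum using (_⊎_; inj₁; inj₂)
open import Function using (_∘_; id)
open import Relation.Binary.PropositionalEquality
open import Relation.Nullary using (¬_; Dec; yes; no; contradiction)

-- Finite sums and triangular numbers

∑< : ℕ → (ℕ → ℕ) → ℕ
∑< zero    f = 0
∑< (suc n) f = f 0 + ∑< n (f ∘ suc)

∑<-cong : ∀ n {f g} → (∀ r → r < n → f r ≡ g r) → ∑< n f ≡ ∑< n g
∑<-cong zero    f≡g = refl
∑<-cong (suc n) f≡g = cong₂ _+_ (f≡g 0 z<s) (∑<-cong n (λ r r<n → f≡g (suc r) (s<s r<n)))

∑<-mono-≤ : ∀ n {f g} → (∀ r → f r ≤ g r) → ∑< n f ≤ ∑< n g
∑<-mono-≤ zero    f≤g = z≤n
∑<-mono-≤ (suc n) f≤g = +-mono-≤ (f≤g 0) (∑<-mono-≤ n (f≤g ∘ suc))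

∑<-distrib-+ : ∀ n f g → ∑< n (λ r → f r + g r) ≡ ∑< n f + ∑< n g
∑<-distrib-+ zero    f g = refl
∑<-distrib-+ (suc n) f g rewrite ∑<-distrib-+ n (f ∘ suc) (g ∘ suc) =
  +-assoc-swap (f 0) (g 0) (∑< n (f ∘ suc)) (∑< n (g ∘ suc))
  where
  +-assoc-swap : ∀ a b c d → a + b + (c + d) ≡ a + c + (b + d)
  +-assoc-swap = solve-∀

∑<-const : ∀ n c → ∑< n (λ _ → c) ≡ n * c
∑<-const zero    c = refl
∑<-const (suc n) c = cong (c +_) (∑<-const n c)

∑<-*ˡ : ∀ n c f → ∑< n (λ r → c * f r) ≡ c * ∑< n f
∑<-*ˡ zero    c f = sym (*-zeroʳ c)
∑<-*ˡ (suc n) c f = trans (cong (c * f 0 +_) (∑<-*ˡ n c (f ∘ suc))) (sym (*-distribˡ-+ c (f 0) _))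

∑<-id : ∀ n → ∑< (suc n) (λ r → r) ≡ T n
∑<-id zero    = refl
∑<-id (suc n) = begin
  ∑< (suc n) (λ r → 1 + r)       ≡⟨ ∑<-distrib-+ (suc n) (λ _ → 1) (λ r → r) ⟩
  ∑< (suc n) (λ _ → 1) + ∑< (suc n) (λ r → r) ≡⟨ cong₂ _+_ (trans (∑<-const (suc n) 1) (*-identityʳ (suc n))) (∑<-id n) ⟩
  suc n + T n                    ∎
  where open ≡-Reasoning

T-double : ∀ n → 2 * T n ≡ n * suc n
T-double zero    = refl
T-double (suc n) = begin
  2 * (suc n + T n)        ≡⟨ *-distribˡ-+ 2 (suc n) (T n) ⟩
  2 * suc n + 2 * T n      ≡⟨ cong (2 * suc n +_) (T-double n) ⟩
  2 * suc n + n * suc n    ≡⟨ expand n ⟩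
  suc n * suc (suc n)      ∎
  where
  open ≡-Reasoning
  expand : ∀ n → 2 * suc n + n * suc n ≡ suc n * suc (suc n)
  expand = solve-∀

T-consecutive : ∀ n → T n + T (suc n) ≡ suc n * suc n
T-consecutive n = *-cancelˡ-≡ (T n + T (suc n)) (suc n * suc n) 2 (begin
  2 * (T n + T (suc n))                ≡⟨ *-distribˡ-+ 2 (T n) (T (suc n)) ⟩
  2 * T n + 2 * T (suc n)              ≡⟨ cong₂ _+_ (T-double n) (T-double (suc n)) ⟩
  n * suc n + suc n * suc (suc n)      ≡⟨ square n ⟩
  2 * (suc n * suc n)                  ∎)
  where
  open ≡-Reasoning
  square : ∀ n → n * suc n + suc n * suc (suc n) ≡ 2 * (suc n * suc n)
  square = solve-∀

undouble : ∀ n u e → 2 * (suc n * u) + e * suc e ≡ u * suc u + n * suc n → suc n * u ≤ T u + T n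
undouble n u e eq = *-cancelˡ-≤ 2 (begin
  2 * (suc n * u)                  ≤⟨ m≤m+n _ _ ⟩
  2 * (suc n * u) + e * suc e      ≡⟨ eq ⟩
  u * suc u + n * suc n            ≡⟨ sym (cong₂ _+_ (T-double u) (T-double n)) ⟩
  2 * T u + 2 * T n                ≡⟨ sym (*-distribˡ-+ 2 (T u) (T n)) ⟩
  2 * (T u + T n)                  ∎)
  where open ≤-Reasoning

-- Doubled, this is (u - n)(u - n - 1) ≥ 0: a product of consecutive integers.
T-tangent : ∀ n u → suc n * u ≤ T u + T n
T-tangent n u with ≤-<-connex u n
... | inj₁ u≤n with e , refl ← m≤n⇒∃[o]m+o≡n u≤n = undouble (u + e) u e (below u e)
  where
  below : ∀ u e → 2 * (suc (u + e) * u) + e * suc e ≡ u * suc u + (u + e) * suc (u + e)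
  below = solve-∀
... | inj₂ n<u with e , refl ← m≤n⇒∃[o]m+o≡n n<u = undouble n (suc (n + e)) e (above n e)
  where
  above : ∀ n e → 2 * (suc n * suc (n + e)) + e * suc e ≡ suc (n + e) * suc (suc (n + e)) + n * suc n
  above = solve-∀

T-scale : ∀ k → k * T (suc k) ≡ suc (suc k) * T k
T-scale k = *-cancelˡ-≡ (k * T (suc k)) (suc (suc k) * T k) 2 (begin
  2 * (k * T (suc k))               ≡⟨ *-comm-middle 2 k (T (suc k)) ⟩
  k * (2 * T (suc k))               ≡⟨ cong (k *_) (T-double (suc k)) ⟩
  k * (suc k * suc (suc k))         ≡⟨ reorder k ⟩
  suc (suc k) * (k * suc k)         ≡⟨ cong (suc (suc k) *_) (sym (T-double k)) ⟩
  suc (suc k) * (2 * T k)           ≡⟨ *-comm-middle (suc (suc k)) 2 (T k) ⟩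
  2 * (suc (suc k) * T k)           ∎)
  where
  open ≡-Reasoning
  *-comm-middle : ∀ a b c → a * (b * c) ≡ b * (a * c)
  *-comm-middle = solve-∀
  reorder : ∀ k → k * (suc k * suc (suc k)) ≡ suc (suc k) * (k * suc k)
  reorder = solve-∀

∑<-tangent : ∀ n m u → suc m * ∑< n u ≤ ∑< n (T ∘ u) + n * T m
∑<-tangent n m u = begin
  suc m * ∑< n u                      ≡⟨ sym (∑<-*ˡ n (suc m) u) ⟩
  ∑< n (λ r → suc m * u r)            ≤⟨ ∑<-mono-≤ n (λ r → T-tangent m (u r)) ⟩
  ∑< n (λ r → T (u r) + T m)          ≡⟨ ∑<-distrib-+ n (T ∘ u) (λ _ → T m) ⟩
  ∑< n (T ∘ u) + ∑< n (λ _ → T m)     ≡⟨ cong (∑< n (T ∘ u) +_) (∑<-const n (T m)) ⟩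
  ∑< n (T ∘ u) + n * T m              ∎
  where open ≤-Reasoning

-- Summing the tangent bound of T at its tangency points k + 1, k + 2 almost gives the claim;
-- the missing 1 comes from u 0 = k, where the bound is strict.
∑<-T-exceeds : ∀ k M u → u 0 ≡ k → ∑< (suc k) u ≡ M + T k → T (suc k) ≤ M
          → suc k * M < ∑< (suc k) (T ∘ u)
∑<-T-exceeds k M u u0≡k Σu big = +-cancelʳ-≤ M (suc (q * M)) A (begin
  suc (q * M) + M                  ≡⟨ shuffle (q * M) M ⟩
  suc q * M + 1                    ≤⟨ +-cancelʳ-≤ (suc q * T k) _ _ summed ⟩
  A + T q                          ≤⟨ +-monoʳ-≤ A big ⟩
  A + M                            ∎)
  where
  open ≤-Reasoning
  q = suc k
  A = ∑< q (T ∘ u)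
  B = ∑< k (T ∘ u ∘ suc)
  shuffle : ∀ x m → suc x + m ≡ m + x + 1
  shuffle = solve-∀
  first : suc q * u 0 + 1 ≡ T (u 0) + T q
  first rewrite u0≡k = trans (square k) (sym (T-consecutive k))
    where
    square : ∀ k → suc (suc k) * k + 1 ≡ suc k * suc k
    square = solve-∀
  summed : suc q * M + 1 + suc q * T k ≤ A + T q + suc q * T k
  summed = begin
    suc q * M + 1 + suc q * T k                     ≡⟨ regroup (suc q) M (T k) ⟩
    suc q * (M + T k) + 1                           ≡⟨ cong (λ s → suc q * s + 1) (sym Σu) ⟩
    suc q * (u 0 + ∑< k (u ∘ suc)) + 1              ≡⟨ split (suc q) (u 0) (∑< k (u ∘ suc)) ⟩
    (suc q * u 0 + 1) + suc q * ∑< k (u ∘ suc)      ≤⟨ +-mono-≤ (≤-reflexive first) (∑<-tangent k q (u ∘ suc)) ⟩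
    (T (u 0) + T q) + (B + k * T q)                 ≡⟨ cong (λ x → T (u 0) + T q + (B + x)) (T-scale k) ⟩
    (T (u 0) + T q) + (B + suc q * T k)             ≡⟨ collect (T (u 0)) (T q) B (suc q * T k) ⟩
    A + T q + suc q * T k                           ∎
    where
    regroup : ∀ a m t → a * m + 1 + a * t ≡ a * (m + t) + 1
    regroup = solve-∀
    split : ∀ a x s → a * (x + s) + 1 ≡ a * x + 1 + a * s
    split = solve-∀
    collect : ∀ a b c d → a + b + (c + d) ≡ a + c + b + d
    collect = solve-∀

-- The mancala move

at-addOnes-≤ : ∀ m xs i → suc i ≤ m → at (addOnes m xs) (suc i) ≡ suc (at xs (suc i))
at-addOnes-≤ (suc m) []       zero    _         = refl
at-addOnes-≤ (suc m) (y ∷ ys) zero    _         = refl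
at-addOnes-≤ (suc m) []       (suc i) (s≤s i<m) = at-addOnes-≤ m [] i i<m
at-addOnes-≤ (suc m) (y ∷ ys) (suc i) (s≤s i<m) = at-addOnes-≤ m ys i i<m

at-addOnes-> : ∀ m xs i → m < suc i → at (addOnes m xs) (suc i) ≡ at xs (suc i)
at-addOnes-> zero    xs       i       _         = refl
at-addOnes-> (suc m) []       (suc i) (s≤s m≤i) = at-addOnes-> m [] i m≤i
at-addOnes-> (suc m) (y ∷ ys) (suc i) (s≤s m≤i) = at-addOnes-> m ys i m≤i

at-Φ-sown : ∀ c i → suc i ≤ at c 1 → at (Φ c) (suc i) ≡ suc (at c (suc (suc i)))
at-Φ-sown (x ∷ xs) i i<x = at-addOnes-≤ x xs i i<x

at-Φ-unsown : ∀ c i → at c 1 < suc i → at (Φ c) (suc i) ≡ at c (suc (suc i))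
at-Φ-unsown []       i _   = refl
at-Φ-unsown (x ∷ xs) i x≤i = at-addOnes-> x xs i x≤i

at-Φ-≥ : ∀ c i → at c (suc (suc i)) ≤ at (Φ c) (suc i)
at-Φ-≥ c i with suc i ≤? at c 1
... | yes i<x = ≤-trans (n≤1+n _) (≤-reflexive (sym (at-Φ-sown c i i<x)))
... | no  i≮x = ≤-reflexive (sym (at-Φ-unsown c i (≰⇒> i≮x)))

IsConfig-addOnes : ∀ m xs → IsConfig xs → IsConfig (addOnes m xs)
IsConfig-addOnes zero    xs       cxs        = cxs
IsConfig-addOnes (suc m) []       cxs        = s≤s z≤n ∷ IsConfig-addOnes m [] []
IsConfig-addOnes (suc m) (y ∷ ys) (_ ∷ cys) = s≤s z≤n ∷ IsConfig-addOnes m ys cys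

IsConfig-Φ : ∀ c → IsConfig c → IsConfig (Φ c)
IsConfig-Φ []       cc        = cc
IsConfig-Φ (x ∷ xs) (_ ∷ cxs) = IsConfig-addOnes x xs cxs

mass-addOnes : ∀ m xs → mass (addOnes m xs) ≡ m + mass xs
mass-addOnes zero    xs       = refl
mass-addOnes (suc m) []       = cong suc (mass-addOnes m [])
mass-addOnes (suc m) (y ∷ ys) = cong suc (trans (cong (y +_) (mass-addOnes m ys)) (+-comm-middle y m (mass ys)))
  where
  +-comm-middle : ∀ a b c → a + (b + c) ≡ b + (a + c)
  +-comm-middle = solve-∀

mass-Φ : ∀ c → mass (Φ c) ≡ mass c
mass-Φ []       = refl
mass-Φ (x ∷ xs) = mass-addOnes x xs

Φ^-+ : ∀ a b c → Φ^ (a + b) c ≡ Φ^ a (Φ^ b c)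
Φ^-+ zero    b c = refl
Φ^-+ (suc a) b c = cong Φ (Φ^-+ a b c)

Φ^-suc : ∀ n c → Φ^ (suc n) c ≡ Φ^ n (Φ c)
Φ^-suc n c = trans (cong (λ m → Φ^ m c) (+-comm 1 n)) (Φ^-+ n 1 c)

mass-Φ^ : ∀ n c → mass (Φ^ n c) ≡ mass c
mass-Φ^ zero    c = refl
mass-Φ^ (suc n) c = trans (mass-Φ (Φ^ n c)) (mass-Φ^ n c)

-- potential λ = ∑ᵢ i λᵢ
potential : Config → ℕ
potential []       = 0
potential (x ∷ xs) = mass (x ∷ xs) + potential xs

potential-addOnes : ∀ m xs → potential (addOnes m xs) ≡ potential xs + T m
potential-addOnes zero    xs = sym (+-identityʳ _)
potential-addOnes (suc m) [] rewrite mass-addOnes m [] | potential-addOnes m [] = regroup m (T m)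
  where
  regroup : ∀ m t → suc (m + 0 + t) ≡ suc (m + t)
  regroup = solve-∀
potential-addOnes (suc m) (y ∷ ys) rewrite mass-addOnes m ys | potential-addOnes m ys =
  regroup y m (mass ys) (potential ys) (T m)
  where
  regroup : ∀ y m s p t → suc (y + (m + s) + (p + t)) ≡ y + s + p + suc (m + t)
  regroup = solve-∀

-- Every stone moves one column left, and the λ₁ sown stones land in columns 1, …, λ₁.
potential-Φ : ∀ c → potential (Φ c) + mass c ≡ potential c + T (at c 1)
potential-Φ []       = refl
potential-Φ (x ∷ xs) rewrite potential-addOnes x xs = regroup (potential xs) (T x) x (mass xs)
  where
  regroup : ∀ p t x s → p + t + (x + s) ≡ x + s + p + t
  regroup = solve-∀

potential-Φ^ : ∀ n c → potential (Φ^ n c) + n * mass c ≡ potential c + ∑< n (λ r → T (at (Φ^ r c) 1))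
potential-Φ^ zero    c = refl
potential-Φ^ (suc n) c = begin
  potential (Φ^ (suc n) c) + suc n * mass c
    ≡⟨ regroup (potential (Φ^ (suc n) c)) (mass c) (n * mass c) ⟩
  (potential (Φ^ (suc n) c) + n * mass c) + mass c
    ≡⟨ cong₂ (λ d m → potential d + n * m + mass c) (Φ^-suc n c) (sym (mass-Φ c)) ⟩
  (potential (Φ^ n (Φ c)) + n * mass (Φ c)) + mass c
    ≡⟨ cong (_+ mass c) (potential-Φ^ n (Φ c)) ⟩
  (potential (Φ c) + ∑< n (λ r → T (at (Φ^ r (Φ c)) 1))) + mass c
    ≡⟨ regroup′ (potential (Φ c)) _ (mass c) ⟩
  (potential (Φ c) + mass c) + ∑< n (λ r → T (at (Φ^ r (Φ c)) 1))
    ≡⟨ cong₂ _+_ (potential-Φ c) (∑<-cong n (λ r _ → cong (λ d → T (at d 1)) (sym (Φ^-suc r c)))) ⟩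
  (potential c + T (at c 1)) + ∑< n (λ r → T (at (Φ^ (suc r) c) 1))
    ≡⟨ +-assoc (potential c) _ _ ⟩
  potential c + ∑< (suc n) (λ r → T (at (Φ^ r c) 1)) ∎
  where
  open ≡-Reasoning
  regroup : ∀ p m s → p + (m + s) ≡ p + s + m
  regroup = solve-∀
  regroup′ : ∀ p s m → p + s + m ≡ p + m + s
  regroup′ = solve-∀

potential≤ℓ*mass : ∀ c → potential c ≤ ℓ c * mass c
potential≤ℓ*mass []       = z≤n
potential≤ℓ*mass (x ∷ xs) =
  +-monoʳ-≤ (x + mass xs) (≤-trans (potential≤ℓ*mass xs) (*-monoʳ-≤ (ℓ xs) (m≤n+m (mass xs) x)))

at-pos : ∀ c i → IsConfig c → i < ℓ c → 1 ≤ at c (suc i)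
at-pos (x ∷ xs) zero    (1≤x ∷ _)  _         = 1≤x
at-pos (x ∷ xs) (suc i) (_ ∷ cxs) (s≤s i<ℓ) = at-pos xs i cxs i<ℓ

at-pos⇒<ℓ : ∀ c i → 1 ≤ at c (suc i) → i < ℓ c
at-pos⇒<ℓ (x ∷ xs) zero    _   = s≤s z≤n
at-pos⇒<ℓ (x ∷ xs) (suc i) pos = s≤s (at-pos⇒<ℓ xs i pos)

at≡0⇒ℓ≤ : ∀ c i → IsConfig c → at c (suc i) ≡ 0 → ℓ c ≤ i
at≡0⇒ℓ≤ c i cc at≡0 with ℓ c ≤? i
... | yes ℓ≤i = ℓ≤i
... | no  ℓ≰i = contradiction (subst (1 ≤_) at≡0 (at-pos c i cc (≰⇒> ℓ≰i))) λ ()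

mass≡∑<at : ∀ c n → ℓ c ≤ n → mass c ≡ ∑< n (λ r → at c (suc r))
mass≡∑<at []       n       _         = sym (trans (∑<-const n 0) (*-zeroʳ n))
mass≡∑<at (x ∷ xs) (suc n) (s≤s ℓ≤n) = cong (x +_) (mass≡∑<at xs n ℓ≤n)

M+i≡suc-j : ∀ j i → suc i ≤ j → j ∸ suc i + 1 + suc i ≡ suc j
M+i≡suc-j j i i≤j = begin
  j ∸ suc i + 1 + suc i    ≡⟨ +-assoc (j ∸ suc i) 1 (suc i) ⟩
  j ∸ suc i + suc (suc i)  ≡⟨ +-suc (j ∸ suc i) (suc i) ⟩
  suc (j ∸ suc i + suc i)  ≡⟨ cong suc (m∸n+n≡m i≤j) ⟩
  suc j                    ∎
  where open ≡-Reasoning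

≥M⇒occupied : ∀ c j → c ≥M j → ∀ i → 1 ≤ i → i ≤ j → j < at c i + i
≥M⇒occupied c j c≥M (suc i) _ i≤j with c≥M (suc i) (s≤s z≤n)
... | M≤at with suc i ≤? j
... | no  i≰j = contradiction i≤j i≰j
... | yes _   = subst (_≤ at c (suc i) + suc i) (M+i≡suc-j j i i≤j) (+-monoˡ-≤ (suc i) M≤at)

occupied⇒≥M : ∀ c j → (∀ i → 1 ≤ i → i ≤ j → j < at c i + i) → c ≥M j
occupied⇒≥M c j occ (suc i) _ with suc i ≤? j
... | no  _   = z≤n
... | yes i≤j = +-cancelʳ-≤ (suc i) _ _
                  (subst (_≤ at c (suc i) + suc i) (sym (M+i≡suc-j j i i≤j)) (occ (suc i) (s≤s z≤n) i≤j))

-- Extremal witnesses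

least : {P : ℕ → Set} → (∀ n → Dec (P n)) → ∀ {n} → P n → Σ[ m ∈ ℕ ] (P m × (∀ s → s < m → ¬ P s))
least P? {zero}  p0 = 0 , p0 , λ _ ()
least P? {suc n} pn with P? 0
... | yes p0 = 0 , p0 , λ _ ()
... | no ¬p0 with least (P? ∘ suc) pn
...   | m , pm , below = suc m , pm , λ { zero _ → ¬p0 ; (suc s) (s≤s s<m) → below s s<m }

argmax-range : (R : ℕ → ℕ → Set) → ∀ n → (∀ p → 1 ≤ p × p ≤ suc n → Σ[ t ∈ ℕ ] R p t)
        → Σ[ p* ∈ ℕ ] Σ[ t* ∈ ℕ ]
            ((1 ≤ p* × p* ≤ suc n) × R p* t* × (∀ p → 1 ≤ p × p ≤ suc n → Σ[ t ∈ ℕ ] (R p t × t ≤ t*)))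
argmax-range R zero    value with value 1 (s≤s z≤n , s≤s z≤n)
... | t , r = 1 , t , (s≤s z≤n , s≤s z≤n) , r , λ { (suc zero) _ → t , r , ≤-refl ; (suc (suc _)) (_ , s≤s ()) }
argmax-range R (suc n) value
  with argmax-range R n (λ p (1≤p , p≤n) → value p (1≤p , m≤n⇒m≤1+n p≤n)) | value (suc (suc n)) (s≤s z≤n , ≤-refl)
... | p₀ , t₀ , (1≤p₀ , p₀≤n) , r₀ , below₀ | t₁ , r₁ with t₁ ≤? t₀
...   | yes t₁≤t₀ = p₀ , t₀ , (1≤p₀ , m≤n⇒m≤1+n p₀≤n) , r₀ , below
  where
  below : ∀ p → 1 ≤ p × p ≤ suc (suc n) → Σ[ t ∈ ℕ ] (R p t × t ≤ t₀)
  below p (1≤p , p≤n+2) with m≤n⇒m<n∨m≡n p≤n+2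
  ... | inj₁ (s≤s p≤n) = below₀ p (1≤p , p≤n)
  ... | inj₂ refl      = t₁ , r₁ , t₁≤t₀
...   | no  t₁≰t₀ = suc (suc n) , t₁ , (s≤s z≤n , ≤-refl) , r₁ , below
  where
  below : ∀ p → 1 ≤ p × p ≤ suc (suc n) → Σ[ t ∈ ℕ ] (R p t × t ≤ t₁)
  below p (1≤p , p≤n+2) with m≤n⇒m<n∨m≡n p≤n+2
  ... | inj₁ (s≤s p≤n) with below₀ p (1≤p , p≤n)
  ...   | t , r , t≤t₀ = t , r , ≤-trans t≤t₀ (<⇒≤ (≰⇒> t₁≰t₀))
  below p _ | inj₂ refl = t₁ , r₁ , ≤-refl

-- Level q = k + 1

module Rotation (k : ℕ) where

  q : ℕ
  q = suc k

  Column : ℕ → Set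
  Column p = 1 ≤ p × p ≤ q

  rotL : ℕ → ℕ
  rotL zero          = zero
  rotL (suc zero)    = q
  rotL (suc (suc m)) = suc m

  rotL^ : ℕ → ℕ → ℕ
  rotL^ zero    p = p
  rotL^ (suc t) p = rotL (rotL^ t p)

  rotL-Column : ∀ p → Column p → Column (rotL p)
  rotL-Column (suc zero)    _         = s≤s z≤n , ≤-refl
  rotL-Column (suc (suc m)) (_ , m<q) = s≤s z≤n , ≤-trans (n≤1+n _) m<q

  rotL^-Column : ∀ t p → Column p → Column (rotL^ t p)
  rotL^-Column zero    p col = col
  rotL^-Column (suc t) p col = rotL-Column _ (rotL^-Column t p col)

  rotL^-+ : ∀ a b p → rotL^ (a + b) p ≡ rotL^ a (rotL^ b p)
  rotL^-+ zero    b p = refl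
  rotL^-+ (suc a) b p = cong rotL (rotL^-+ a b p)

  rotL^-suc : ∀ t p → rotL^ (suc t) p ≡ rotL^ t (rotL p)
  rotL^-suc t p = trans (cong (λ s → rotL^ s p) (+-comm 1 t)) (rotL^-+ t 1 p)

  rotL^-down : ∀ t m → rotL^ t (suc (t + m)) ≡ suc m
  rotL^-down zero    m = refl
  rotL^-down (suc t) m = trans (rotL^-suc t (suc (suc t + m))) (rotL^-down t m)

  rotL^-to-1 : ∀ s → rotL^ s (suc s) ≡ 1
  rotL^-to-1 s = trans (cong (λ m → rotL^ s (suc m)) (sym (+-identityʳ s))) (rotL^-down s 0)

  rotL^-period : ∀ p → Column p → rotL^ q p ≡ p
  rotL^-period (suc s) (_ , s≤s s≤k) = begin
    rotL^ (suc k) (suc s)                   ≡⟨ cong (λ t → rotL^ t (suc s)) q≡ ⟩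
    rotL^ (k ∸ s + suc s) (suc s)           ≡⟨ rotL^-+ (k ∸ s) (suc s) (suc s) ⟩
    rotL^ (k ∸ s) (rotL (rotL^ s (suc s)))  ≡⟨ cong (λ p → rotL^ (k ∸ s) (rotL p)) (rotL^-to-1 s) ⟩
    rotL^ (k ∸ s) (suc k)                   ≡⟨ cong (λ m → rotL^ (k ∸ s) (suc m)) (sym (m∸n+n≡m s≤k)) ⟩
    rotL^ (k ∸ s) (suc (k ∸ s + s))         ≡⟨ rotL^-down (k ∸ s) s ⟩
    suc s                                   ∎
    where
    open ≡-Reasoning
    q≡ : suc k ≡ k ∸ s + suc s
    q≡ = trans (cong suc (sym (m∸n+n≡m s≤k))) (sym (+-suc (k ∸ s) s))

  rotL^-period-* : ∀ j p → Column p → rotL^ (j * q) p ≡ p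
  rotL^-period-* zero    p col = refl
  rotL^-period-* (suc j) p col =
    trans (rotL^-+ q (j * q) p) (trans (cong (rotL^ q) (rotL^-period-* j p col)) (rotL^-period p col))

  rotL-injective : ∀ a b → Column a → Column b → rotL a ≡ rotL b → a ≡ b
  rotL-injective (suc zero)    (suc zero)    _            _            _  = refl
  rotL-injective (suc zero)    (suc (suc m)) _            (_ , s≤s m<k) eq = contradiction (subst (_≤ k) (sym eq) m<k) (1+n≰n)
  rotL-injective (suc (suc m)) (suc zero)    (_ , s≤s m<k) _           eq = contradiction (subst (_≤ k) eq m<k) (1+n≰n)
  rotL-injective (suc (suc m)) (suc (suc n)) _            _            eq = cong suc eq

  rotL^-injective : ∀ t a b → Column a → Column b → rotL^ t a ≡ rotL^ t b → a ≡ b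
  rotL^-injective zero    a b _    _    eq = eq
  rotL^-injective (suc t) a b cola colb eq =
    rotL^-injective t a b cola colb (rotL-injective _ _ (rotL^-Column t a cola) (rotL^-Column t b colb) eq)

  rotL-surjective : ∀ j → Column j → Σ[ p ∈ ℕ ] (Column p × rotL p ≡ j)
  rotL-surjective (suc m) (_ , s≤s m≤k) with m ≟ k
  ... | yes refl = 1 , (s≤s z≤n , s≤s z≤n) , refl
  ... | no  m≢k  = suc (suc m) , (s≤s z≤n , s≤s (≤∧≢⇒< m≤k m≢k)) , refl

  rotL^-surjective : ∀ t j → Column j → Σ[ p ∈ ℕ ] (Column p × rotL^ t p ≡ j)
  rotL^-surjective zero    j col = j , col , refl
  rotL^-surjective (suc t) j col with rotL-surjective j col
  ... | j′ , col′ , rotL-j′ with rotL^-surjective t j′ col′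
  ... | p , colp , rotL^-p = p , colp , trans (cong rotL rotL^-p) rotL-j′

  rotL^-reaches-q : ∀ p → Column p → Σ[ i ∈ ℕ ] (i < q × rotL^ i p ≡ q)
  rotL^-reaches-q (suc s) (_ , s≤s s≤k) with m≤n⇒m<n∨m≡n s≤k
  ... | inj₁ s<k  = suc s , s≤s s<k , cong rotL (rotL^-to-1 s)
  ... | inj₂ refl = 0 , s≤s z≤n , refl

  private
    k%q≡k : k % q ≡ k
    k%q≡k = m<n⇒m%n≡m (≤-refl {q})

    rotL-mod : ∀ y → suc ((y + k) % q) ≡ rotL (suc (y % q))
    rotL-mod y = begin
      suc ((y + k) % q)             ≡⟨ cong suc (%-distribˡ-+ y k q) ⟩
      suc ((y % q + k % q) % q)     ≡⟨ cong (λ z → suc ((y % q + z) % q)) k%q≡k ⟩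
      suc ((y % q + k) % q)         ≡⟨ step (y % q) (m%n<n y q) ⟩
      rotL (suc (y % q))            ∎
      where
      open ≡-Reasoning
      step : ∀ r → r < q → suc ((r + k) % q) ≡ rotL (suc r)
      step zero    _         = cong suc k%q≡k
      step (suc r) (s≤s r<k) =
        cong suc (trans (cong (_% q) (sym (+-suc r k))) (trans ([m+n]%n≡m%n r q) (m<n⇒m%n≡m (<-trans (n<1+n r) (s≤s r<k)))))

  rot≡rotL^ : ∀ p t → Column p → rot q p t ≡ rotL^ t p
  rot≡rotL^ (suc p) zero    (_ , s≤s p≤k) =
    cong suc (trans (cong (λ x → (p + x) % q) (*-zeroʳ k)) (trans (cong (_% q) (+-identityʳ p)) (m≤n⇒m%n≡m p≤k)))
  rot≡rotL^ (suc p) (suc t) col =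
    trans (cong (λ x → suc (x % q)) (regroup k p t)) (trans (rotL-mod (p + k * t)) (cong rotL (rot≡rotL^ (suc p) t col)))
    where
    regroup : ∀ k p t → p + k * suc t ≡ p + k * t + k
    regroup = solve-∀

module Level (k : ℕ) (k≥1 : 1 ≤ k) where

  open Rotation k

  Admissible : Config → Set
  Admissible c = IsConfig c × c ≥M k

  -- Occ c p q without the range conditions on p
  Occupied : Config → ℕ → Set
  Occupied c p = q < at c p + p

  Occupied? : ∀ c p → Dec (Occupied c p)
  Occupied? c p = q <? at c p + p

  k≤head : ∀ c → Admissible c → k ≤ at c 1
  k≤head c (_ , c≥M) = ≤-pred (subst (k <_) (+-comm (at c 1) 1) (≥M⇒occupied c k c≥M 1 (s≤s z≤n) k≥1))

  -- As λ₁ ≥ k, the first k columns are sown: each cell there moves one column left along its level.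
  at-Φ-diagonal : ∀ c → Admissible c → ∀ m → suc m ≤ k
                → at (Φ c) (suc m) + suc m ≡ at c (suc (suc m)) + suc (suc m)
  at-Φ-diagonal c adm m m<k =
    trans (cong (_+ suc m) (at-Φ-sown c m (≤-trans m<k (k≤head c adm)))) (sym (+-suc _ (suc m)))

  Admissible-Φ : ∀ c → Admissible c → Admissible (Φ c)
  Admissible-Φ c adm@(cc , c≥M) = IsConfig-Φ c cc , occupied⇒≥M (Φ c) k occ
    where
    occ : ∀ i → 1 ≤ i → i ≤ k → k < at (Φ c) i + i
    occ (suc m) _ m<k with suc (suc m) ≤? k
    ... | yes m+1<k = subst (k <_) (sym (at-Φ-diagonal c adm m m<k)) (≥M⇒occupied c k c≥M (suc (suc m)) (s≤s z≤n) m+1<k)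
    ... | no  m+1≮k = subst (k <_) (sym (at-Φ-diagonal c adm m m<k)) (<-≤-trans (≰⇒> m+1≮k) (m≤n+m _ _))

  Admissible-Φ^ : ∀ n c → Admissible c → Admissible (Φ^ n c)
  Admissible-Φ^ zero    c adm = adm
  Admissible-Φ^ (suc n) c adm = Admissible-Φ _ (Admissible-Φ^ n c adm)

  at-Φ^-diagonal : ∀ c → Admissible c → ∀ r i → i + r ≤ k
                 → at (Φ^ r c) (suc i) + suc i ≡ at c (suc (i + r)) + suc (i + r)
  at-Φ^-diagonal c adm zero    i _ rewrite +-identityʳ i = refl
  at-Φ^-diagonal c adm (suc r) i i+r<k rewrite +-suc i r = begin
    at (Φ (Φ^ r c)) (suc i) + suc i             ≡⟨ at-Φ-diagonal (Φ^ r c) (Admissible-Φ^ r c adm) i (≤-trans (s≤s (m≤m+n i r)) i+r<k) ⟩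
    at (Φ^ r c) (suc (suc i)) + suc (suc i)     ≡⟨ at-Φ^-diagonal c adm r (suc i) i+r<k ⟩
    at c (suc (suc (i + r))) + suc (suc (i + r)) ∎
    where open ≡-Reasoning

  occupied-rotL : ∀ c p → Admissible c → Column p → Occupied c p → Occupied (Φ c) (rotL p)
  occupied-rotL c (suc zero)    adm _           occ =
    subst (λ x → q < x + q) (sym (at-Φ-sown c k (≤-pred (subst (q <_) (+-comm (at c 1) 1) occ)))) (s≤s (m≤n+m _ _))
  occupied-rotL c (suc (suc m)) adm (_ , s≤s m<k) occ = subst (q <_) (sym (at-Φ-diagonal c adm m m<k)) occ

  occupied-rotL⁻¹ : ∀ c m → Admissible c → suc (suc m) ≤ q → Occupied (Φ c) (suc m) → Occupied c (suc (suc m))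
  occupied-rotL⁻¹ c m adm (s≤s m<k) occ = subst (q <_) (at-Φ-diagonal c adm m m<k) occ

  occupied-from-overflow : ∀ c → 1 ≤ at c (suc q) → Occupied (Φ c) q
  occupied-from-overflow c pos = +-monoˡ-≤ q (≤-trans pos (at-Φ-≥ c k))

  unoccupied-top : ∀ c → ¬ Occupied c q → at c q ≡ 0
  unoccupied-top c ¬occ with at c q
  ... | zero  = refl
  ... | suc _ = contradiction (s≤s (m≤n+m _ _)) ¬occ

  ℓ≡k : ∀ c → Admissible c → ¬ Occupied c q → ℓ c ≡ k
  ℓ≡k c (cc , c≥M) ¬occ = ≤-antisym (at≡0⇒ℓ≤ c k cc (unoccupied-top c ¬occ)) (k≤ℓ k≥1)
    where
    k≤ℓ : 1 ≤ k → k ≤ ℓ c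
    k≤ℓ (s≤s {n = k′} _) =
      at-pos⇒<ℓ c k′ (+-cancelʳ-≤ k 1 (at c k) (≥M⇒occupied c k c≥M k k≥1 ≤-refl))

  -- The cell starting in column p of level q, followed as it rotates left, is occupied at time t.
  Lit : Config → ℕ → ℕ → Set
  Lit c p t = Occupied (Φ^ t c) (rotL^ t p)

  Lit-step : ∀ c p t → Admissible c → Column p → Lit c p t → Lit c p (suc t)
  Lit-step c p t adm col = occupied-rotL (Φ^ t c) (rotL^ t p) (Admissible-Φ^ t c adm) (rotL^-Column t p col)

  Lit-mono : ∀ c p {s} t → Admissible c → Column p → s ≤ t → Lit c p s → Lit c p t
  Lit-mono c p zero    adm col z≤n lit = lit
  Lit-mono c p (suc t) adm col s≤t lit with m≤n⇒m<n∨m≡n s≤t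
  ... | inj₁ (s≤s s≤t′) = Lit-step c p t adm col (Lit-mono c p t adm col s≤t′ lit)
  ... | inj₂ refl       = lit

  Lit-Φ^ : ∀ c p i s → Lit (Φ^ i c) (rotL^ i p) s ≡ Lit c p (s + i)
  Lit-Φ^ c p i s = cong₂ Occupied (sym (Φ^-+ s i c)) (sym (rotL^-+ s i p))

  head-after-round : ∀ c → Admissible c → at c 1 ≡ k → at c (suc q) ≡ 0 → at (Φ^ q c) 1 ≡ k
  head-after-round c adm head≡k top≡0 = +-cancelʳ-≡ 1 (at (Φ^ q c) 1) k (begin
    at (Φ^ q c) 1 + 1             ≡⟨ cong (λ d → at d 1 + 1) (Φ^-suc k c) ⟩
    at (Φ^ k (Φ c)) 1 + 1         ≡⟨ at-Φ^-diagonal (Φ c) (Admissible-Φ c adm) k 0 ≤-refl ⟩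
    at (Φ c) (suc k) + suc k      ≡⟨ cong (_+ suc k) (at-Φ-unsown c k (subst (_< suc k) (sym head≡k) ≤-refl)) ⟩
    at c (suc q) + suc k          ≡⟨ cong (_+ suc k) top≡0 ⟩
    suc k                         ≡⟨ +-comm 1 k ⟩
    k + 1                         ∎)
    where open ≡-Reasoning

  potential-rises-over-round : ∀ c → Admissible c → at c 1 ≡ k → at c (suc q) ≡ 0 → T q ≤ mass c
                             → potential c < potential (Φ^ q c)
  potential-rises-over-round c adm@(cc , _) head≡k top≡0 big = +-cancelʳ-≤ (q * mass c) _ _ (begin
    suc (potential c) + q * mass c           ≡⟨ sym (+-suc (potential c) (q * mass c)) ⟩
    potential c + suc (q * mass c)           ≤⟨ +-monoʳ-≤ (potential c) gain ⟩
    potential c + ∑< q (T ∘ u)               ≡⟨ cong (potential c +_) (∑<-cong q (λ r r<q → cong T (sym (head r r<q)))) ⟩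
    potential c + ∑< q (λ r → T (at (Φ^ r c) 1))  ≡⟨ sym (potential-Φ^ q c) ⟩
    potential (Φ^ q c) + q * mass c          ∎)
    where
    open ≤-Reasoning
    u : ℕ → ℕ
    u r = at c (suc r) + r
    head : ∀ r → r < q → at (Φ^ r c) 1 ≡ u r
    head r (s≤s r≤k) = +-cancelʳ-≡ 1 _ _ (trans (at-Φ^-diagonal c adm r 0 r≤k) (shift (at c (suc r)) r))
      where
      shift : ∀ x r → x + suc r ≡ x + r + 1
      shift = solve-∀
    ∑<u : ∑< q u ≡ mass c + T k
    ∑<u = trans (∑<-distrib-+ q (λ r → at c (suc r)) (λ r → r))
                (cong₂ _+_ (sym (mass≡∑<at c q (at≡0⇒ℓ≤ c q cc top≡0))) (∑<-id k))
    gain : q * mass c < ∑< q (T ∘ u)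
    gain = ∑<-T-exceeds k (mass c) u (trans (+-identityʳ _) head≡k) ∑<u big

  -- The potential rises each round but stays below q |λ| while λ_{q+1} = 0.
  overflow : ∀ fuel c → Admissible c → T q ≤ mass c → at c 1 ≡ k → q * mass c < potential c + fuel
           → Σ[ j ∈ ℕ ] (1 ≤ at (Φ^ (j * q) c) (suc q))
  overflow fuel c adm@(cc , _) big head≡k bound with at c (suc q) in top
  ... | suc _ = 0 , subst (1 ≤_) (sym top) (s≤s z≤n)
  ... | zero with fuel
  ...   | zero = contradiction bound (≤⇒≯ (begin
          potential c + 0      ≡⟨ +-identityʳ (potential c) ⟩
          potential c          ≤⟨ potential≤ℓ*mass c ⟩
          ℓ c * mass c         ≤⟨ *-monoˡ-≤ (mass c) (at≡0⇒ℓ≤ c q cc top) ⟩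
          q * mass c           ∎))
    where open ≤-Reasoning
  ...   | suc fuel′ with overflow fuel′ (Φ^ q c) (Admissible-Φ^ q c adm) big′ (head-after-round c adm head≡k top) bound′
    where
    big′ : T q ≤ mass (Φ^ q c)
    big′ = subst (T q ≤_) (sym (mass-Φ^ q c)) big
    bound′ : q * mass (Φ^ q c) < potential (Φ^ q c) + fuel′
    bound′ = begin-strict
      q * mass (Φ^ q c)           ≡⟨ cong (q *_) (mass-Φ^ q c) ⟩
      q * mass c                  <⟨ bound ⟩
      potential c + suc fuel′     ≡⟨ +-suc (potential c) fuel′ ⟩
      suc (potential c) + fuel′   ≤⟨ +-monoˡ-≤ fuel′ (potential-rises-over-round c adm head≡k top big) ⟩
      potential (Φ^ q c) + fuel′  ∎
      where open ≤-Reasoning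
  ... | j , overflowed = suc j , subst (λ d → 1 ≤ at d (suc q)) (sym Φ^-rounds) overflowed
    where
    Φ^-rounds : Φ^ (suc j * q) c ≡ Φ^ (j * q) (Φ^ q c)
    Φ^-rounds = trans (cong (λ n → Φ^ n c) (+-comm q (j * q))) (Φ^-+ (j * q) q c)

  -- An empty corner (1 , q) forces λ₁ = k; the cell is filled as it wraps round to column q
  -- right after the first overflowing round.
  corner-eventually-lit : ∀ c → Admissible c → T q ≤ mass c → ¬ Occupied c 1 → Σ[ j ∈ ℕ ] Lit c 1 (suc (j * q))
  corner-eventually-lit c adm big ¬occ with overflow (suc (q * mass c)) c adm big head≡k (m≤n+m _ _)
    where
    head≡k : at c 1 ≡ k
    head≡k = ≤-antisym (≤-pred (subst (_≤ q) (+-comm (at c 1) 1) (≮⇒≥ ¬occ))) (k≤head c adm)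
  ... | j , overflowed = j , subst (Occupied (Φ (Φ^ (j * q) c)))
                                   (sym (cong rotL (rotL^-period-* j 1 (s≤s z≤n , s≤s z≤n))))
                                   (occupied-from-overflow (Φ^ (j * q) c) overflowed)

  eventually-lit : ∀ c p → Admissible c → T q ≤ mass c → Column p → Σ[ t ∈ ℕ ] Lit c p t
  eventually-lit c (suc s) adm big _ with Occupied? (Φ^ s c) 1
  ... | yes occ = s , subst (Occupied (Φ^ s c)) (sym (rotL^-to-1 s)) occ
  ... | no ¬occ with corner-eventually-lit (Φ^ s c) (Admissible-Φ^ s c adm) (subst (T q ≤_) (sym (mass-Φ^ s c)) big) ¬occ
  ... | j , lit = suc (j * q) + s , subst id (Lit-Φ^ c (suc s) s (suc (j * q)))
                                    (subst (λ p → Lit (Φ^ s c) p (suc (j * q))) (sym (rotL^-to-1 s)) lit)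

  FirstLit : Config → ℕ → ℕ → Set
  FirstLit c p t = Lit c p t × (∀ s → s < t → ¬ Lit c p s)

  first-lit : ∀ c p → Admissible c → T q ≤ mass c → Column p → Σ[ t ∈ ℕ ] FirstLit c p t
  first-lit c p adm big col with eventually-lit c p adm big col
  ... | t , lit = least {Lit c p} (λ s → Occupied? (Φ^ s c) (rotL^ s p)) {t} lit

  first-lit-from-column-1 : ∀ c p t → Admissible c → Column p → FirstLit c p (suc t) → rotL^ t p ≡ 1
  first-lit-from-column-1 c p t adm col (lit , earlier) with rotL^ t p in eq | rotL^-Column t p col
  ... | suc zero    | _            = refl
  ... | suc (suc m) | (_ , m+2≤q) =
    contradiction (subst (Occupied (Φ^ t c)) (sym eq) (occupied-rotL⁻¹ (Φ^ t c) m (Admissible-Φ^ t c adm) m+2≤q lit))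
                  (earlier t ≤-refl)

  first-lit-injective : ∀ c a b t → 1 ≤ t → Admissible c → Column a → Column b
                      → FirstLit c a t → FirstLit c b t → a ≡ b
  first-lit-injective c a b (suc t) _ adm cola colb firsta firstb =
    rotL^-injective t a b cola colb
      (trans (first-lit-from-column-1 c a t adm cola firsta) (sym (first-lit-from-column-1 c b t adm colb firstb)))

  FirstLit-Φ^ : ∀ c p t i → i ≤ t → FirstLit c p t → FirstLit (Φ^ i c) (rotL^ i p) (t ∸ i)
  FirstLit-Φ^ c p t i i≤t (lit , earlier) =
    subst id (sym (Lit-Φ^ c p i (t ∸ i))) (subst (Lit c p) (sym (m∸n+n≡m i≤t)) lit) ,
    λ s s<t∸i → earlier (s + i) (m≤o∸n⇒m+n≤o (suc s) i≤t s<t∸i) ∘ subst id (Lit-Φ^ c p i s)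

  Lit⇒Occ : ∀ c p t → Column p → Lit c p t → Occ (Φ^ t c) (rot q p t) q
  Lit⇒Occ c p t col lit rewrite rot≡rotL^ p t col = proj₁ (rotL^-Column t p col) , proj₂ (rotL^-Column t p col) , lit

  Occ⇒Lit : ∀ c p t → Column p → Occ (Φ^ t c) (rot q p t) q → Lit c p t
  Occ⇒Lit c p t col (_ , _ , occ) = subst (Occupied (Φ^ t c)) (rot≡rotL^ p t col) occ

  FirstLit⇒FilledAt : ∀ c p t → Column p → 1 ≤ t → FirstLit c p t → FilledAt q c p t
  FirstLit⇒FilledAt c p t col 1≤t (lit , earlier) =
    1≤t , Lit⇒Occ c p t col lit , λ s _ s<t → earlier s s<t ∘ Occ⇒Lit c p s col

  FilledAt⇒FirstLit : ∀ c p t → Column p → ¬ Occupied c p → FilledAt q c p t → FirstLit c p t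
  FilledAt⇒FirstLit c p t col gap (_ , occ , earlier) = Occ⇒Lit c p t col occ , before
    where
    before : ∀ s → s < t → ¬ Lit c p s
    before zero    _   = gap
    before (suc s) s<t = earlier (suc s) (s≤s z≤n) s<t ∘ Lit⇒Occ c p (suc s) col

  full-if-all-lit : ∀ c i → Admissible c → (∀ p → Column p → Σ[ t ∈ ℕ ] (t ≤ i × Lit c p t)) → Φ^ i c ≥M q
  full-if-all-lit c i adm lit = occupied⇒≥M (Φ^ i c) q occ
    where
    occ : ∀ j → 1 ≤ j → j ≤ q → q < at (Φ^ i c) j + j
    occ j 1≤j j≤q with rotL^-surjective i j (1≤j , j≤q)
    ... | p , col , rotL^-p≡j with lit p col
    ... | t , t≤i , lit-t = subst (Occupied (Φ^ i c)) rotL^-p≡j (Lit-mono c p i adm col t≤i lit-t)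

  filled-after : ∀ c p t i col → Column p → FirstLit c p t → i < t → rotL^ i p ≡ col
               → FilledAt q (Φ^ i c) col (t ∸ i)
  filled-after c p t i col colp first i<t rotL^-p≡col =
    FirstLit⇒FilledAt (Φ^ i c) col (t ∸ i) (subst Column rotL^-p≡col (rotL^-Column i p colp)) (m<n⇒0<n∸m i<t)
      (subst (λ x → FirstLit (Φ^ i c) x (t ∸ i)) rotL^-p≡col (FirstLit-Φ^ c p t i (<⇒≤ i<t) first))

  LastLit : Config → ℕ → ℕ → Set
  LastLit c p* F = Column p* × FirstLit c p* F × (∀ p → Column p → Σ[ t ∈ ℕ ] (FirstLit c p t × t ≤ F))

  canonical-at : ∀ c p* F i → Admissible c → T q ≤ mass c → LastLit c p* F → rotL^ i p* ≡ q → i < F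
               → Canonical q (Φ^ i c)
  canonical-at c p* F i adm big (col* , first* , latest) rotL^-p*≡q i<F =
    s≤s k≥1 , subst (T q ≤_) (sym (mass-Φ^ i c)) big , proj₂ adm′ , ℓ≡k e adm′ ¬top ,
    (s≤s z≤n , ≤-refl , ¬top ∘ proj₂ ∘ proj₂) ,
    F ∸ i , filled-after c p* F i q col* first* i<F rotL^-p*≡q , earlier-gaps
    where
    e = Φ^ i c
    adm′ = Admissible-Φ^ i c adm
    ¬top : ¬ Occupied e q
    ¬top = subst (λ p → ¬ Occupied e p) rotL^-p*≡q (proj₂ first* i i<F)
    earlier-gaps : ∀ col → Gap q e col → ¬ col ≡ q → Σ[ tc ∈ ℕ ] (FilledAt q e col tc × tc < F ∸ i)
    earlier-gaps col (1≤col , col≤q , ¬occ) col≢q with rotL^-surjective i col (1≤col , col≤q)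
    ... | p , colp , rotL^-p≡col with latest p colp
    ... | t , first , t≤F = t ∸ i , filled-after c p t i col colp first i<t rotL^-p≡col , ∸-monoˡ-< t<F (<⇒≤ i<t)
      where
      i<t : i < t
      i<t = ≰⇒> λ t≤i → ¬occ (1≤col , col≤q ,
              subst (Occupied e) rotL^-p≡col (Lit-mono c p i adm colp t≤i (proj₁ first)))
      t<F : t < F
      t<F = ≤∧≢⇒< t≤F λ t≡F → col≢q (begin
        col          ≡⟨ sym rotL^-p≡col ⟩
        rotL^ i p    ≡⟨ cong (rotL^ i) (first-lit-injective c p p* F (≤-trans (s≤s z≤n) i<F) adm colp col*
                                          (subst (FirstLit c p) t≡F first) first*) ⟩
        rotL^ i p*   ≡⟨ rotL^-p*≡q ⟩
        q            ∎)
        where open ≡-Reasoning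

  full-or-canonical : ∀ c p* F i → Admissible c → T q ≤ mass c → LastLit c p* F → rotL^ i p* ≡ q
                    → Φ^ i c ≥M q ⊎ Canonical q (Φ^ i c)
  full-or-canonical c p* F i adm big last@(_ , _ , latest) rotL^-p*≡q with F ≤? i
  ... | yes F≤i = inj₁ (full-if-all-lit c i adm all-lit)
    where
    all-lit : ∀ p → Column p → Σ[ t ∈ ℕ ] (t ≤ i × Lit c p t)
    all-lit p col with latest p col
    ... | t , (lit , _) , t≤F = t , ≤-trans t≤F F≤i , lit
  ... | no  F≰i = inj₂ (canonical-at c p* F i adm big last rotL^-p*≡q (≰⇒> F≰i))

  reaches-full-or-canonical : ∀ c → Admissible c → T q ≤ mass c
                            → Σ[ i ∈ ℕ ] (i < q × (Φ^ i c ≥M q ⊎ Canonical q (Φ^ i c)))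
  reaches-full-or-canonical c adm big with argmax-range (FirstLit c) k (λ p col → first-lit c p adm big col)
  ... | p* , F , col* , first* , latest with rotL^-reaches-q p* col*
  ... | i , i<q , rotL^-p*≡q = i , i<q , full-or-canonical c p* F i adm big (col* , first* , latest) rotL^-p*≡q

  canonical-step : ∀ c → IsConfig c → Canonical q c → Φ^ q c ≥M q ⊎ Canonical q (Φ^ q c)
  canonical-step c cc (_ , big , c≥M , _ , (_ , _ , ¬occ-q) , tq , filled-q , earlier) =
    full-or-canonical c q tq q (cc , c≥M) big (col-q , first-q , latest) (rotL^-period q col-q)
    where
    col-q : Column q
    col-q = s≤s z≤n , ≤-refl
    first-q : FirstLit c q tq
    first-q = FilledAt⇒FirstLit c q tq col-q (λ occ → ¬occ-q (s≤s z≤n , ≤-refl , occ)) filled-q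
    latest : ∀ p → Column p → Σ[ t ∈ ℕ ] (FirstLit c p t × t ≤ tq)
    latest p col with Occupied? c p
    ... | yes occ = 0 , (occ , λ _ ()) , z≤n
    ... | no ¬occ with p ≟ q
    ...   | yes refl = tq , first-q , ≤-refl
    ...   | no  p≢q with earlier p (proj₁ col , proj₂ col , ¬occ ∘ proj₂ ∘ proj₂) p≢q
    ...     | t , filled , t<tq = t , FilledAt⇒FirstLit c p t col ¬occ filled , <⇒≤ t<tq

nonempty⇒≥M1 : ∀ c → IsConfig c → 1 ≤ mass c → c ≥M 1
nonempty⇒≥M1 []       _          ()
nonempty⇒≥M1 (x ∷ xs) (1≤x ∷ _) _  = occupied⇒≥M (x ∷ xs) 1 λ { (suc zero) _ _ → +-monoˡ-≤ 1 1≤x ; (suc (suc _)) _ (s≤s ()) }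

mainTheorem14 : (q : ℕ) → 1 ≤ q → (c : Config) → IsConfig c
    → c ≥M (q ∸ 1) → T q ≤ mass c
    → (Σ[ i ∈ ℕ ] (i < q × (Φ^ i c ≥M q ⊎ Canonical q (Φ^ i c))))
    × (Canonical q c → Φ^ q c ≥M q ⊎ Canonical q (Φ^ q c))
mainTheorem14 (suc zero) _ c cc _ big =
  (0 , s≤s z≤n , inj₁ (nonempty⇒≥M1 c cc big)) , λ canonical → contradiction (proj₁ canonical) λ { (s≤s ()) }
mainTheorem14 (suc (suc k)) _ c cc c≥M big =
  Level.reaches-full-or-canonical (suc k) (s≤s z≤n) c (cc , c≥M) big ,
  Level.canonical-step (suc k) (s≤s z≤n) c cc
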